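{- Let $\varphi$ be a $\mathrm{D}$-formula, $A,B$ $\varphi$-atoms and $m>rank(B)$ a natural number. Then: (1) $succ_\varphi(B^m,A)$ is of the form $A\,A_1\cdots A_{k-1}A_k^{\ell}$ for some $k,\ell\ge1$, where $A_1,\dots,A_k$ are pairwise distinct $\varphi$-atoms and $\ell>rank(A_k)$ (possibly $A=A_1$); (2) for every $t>0$, $succ_\varphi(B^{m+t},A)=succ_\varphi(B^m,A)\cdot A_k^{t}$.
   Context: Formulas: $\varphi ::= p\mid\neg\varphi\mid\varphi\vee\varphi\mid\langle D\rangle\varphi$, $p\in\mathcal{AP}$; $[D]\psi:=\neg\langle D\rangle\neg\psi$. $\mathrm{CL}(\varphi)$: subformulas and their negations, identifying $\neg\neg\psi$ with $\psi$ and $\neg\langle D\rangle\psi$ with $[D]\neg\psi$. A $\varphi$-atom is $A\subseteq\mathrm{CL}(\varphi)$ with $\psi\in A$ iff $\neg\psi\notin A$, and $\psi_1\vee\psi_2\in A$ iff $\psi_1\in A$ or $\psi_2\in A$. $\mathcal{R}eq_D(A)=\{\psi:\langle D\rangle\psi\in A\}$, $\mathrm{REQ}_\varphi=\{\psi:\langle D\rangle\psi\in\mathrm{CL}(\varphi)\}$, $\mathcal{O}bs_D(A)=A\cap\mathrm{REQ}_\varphi$, $rank(A)=|\mathrm{REQ}_\varphi|-|\mathcal{R}eq_D(A)|$. $A_1A_2\Rightarrow A_3$ iff $A_3\cap\mathcal{AP}=A_1\cap A_2\cap\mathcal{AP}$ and $\mathcal{R}eq_D(A_3)=\mathcal{R}eq_D(A_1)\cup\mathcal{R}eq_D(A_2)\cup\mathcal{O}bs_D(A_1)\cup\mathcal{O}bs_D(A_2)$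 (the atom $A_3$ is uniquely determined by $A_1,A_2$). $B^m$ denotes the sequence of $m$ copies of $B$, and $\cdot$ is concatenation. For a nonempty sequence $row=row[0]\cdots row[n-1]$ of atoms and an atom $A$, $succ_\varphi(row,A)=B_0\cdots B_n$ with $B_0=A$ and $row[i]B_i\Rightarrow B_{i+1}$ for $i\in[0,n-1]$. -}

module Defs where

open import Data.Nat using (ℕ; _∸_; _<_; _+_)
open import Data.Nat.Properties using () renaming (_≟_ to _≟ℕ_)
open import Data.Bool using (Bool; true; false; _∧_)
open import Data.Fin using (Fin)
open import Data.Fin.Subset using (Subset; _∈_; ∣_∣; _∩_)
open import Data.List as L using (List; []; _∷_; _++_; length; deduplicate; concatMap)
open import Data.List.Relation.Unary.Unique.Propositional using (Unique)
open import Data.Vec as V using (Vec; lookup; tabulate; fromList)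
open import Data.Product using (Σ; _×_; _,_)
open import Data.Sum using (_⊎_)
open import Relation.Nullary using (¬_; yes; no)
open import Relation.Binary.PropositionalEquality using (_≡_; refl; cong; cong₂)
open import Relation.Binary.Definitions using (DecidableEquality)
open import Function.Bundles using (_⇔_)

data Formula : Set where
  prop : ℕ → Formula
  neg  : Formula → Formula
  or   : Formula → Formula → Formula
  dia  : Formula → Formula

box : Formula → Formula
box ψ = neg (dia (neg ψ))

infix 4 _≟F_
_≟F_ : DecidableEquality Formula
prop p ≟F prop q with p ≟ℕ q
... | yes refl = yes refl
... | no ne = no λ { refl → ne refl }
prop _ ≟F neg _ = no λ ()
prop _ ≟F or _ _ = no λ ()
prop _ ≟F dia _ = no λ ()
neg _ ≟F prop _ = no λ ()
neg a ≟F neg b with a ≟F b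
... | yes refl = yes refl
... | no ne = no λ { refl → ne refl }
neg _ ≟F or _ _ = no λ ()
neg _ ≟F dia _ = no λ ()
or _ _ ≟F prop _ = no λ ()
or _ _ ≟F neg _ = no λ ()
or a b ≟F or c d with a ≟F c | b ≟F d
... | yes refl | yes refl = yes refl
... | no ne | _ = no λ { refl → ne refl }
... | yes _ | no ne = no λ { refl → ne refl }
or _ _ ≟F dia _ = no λ ()
dia _ ≟F prop _ = no λ ()
dia _ ≟F neg _ = no λ ()
dia _ ≟F or _ _ = no λ ()
dia a ≟F dia b with a ≟F b
... | yes refl = yes refl
... | no ne = no λ { refl → ne refl }

-- Identification ¬¬ψ = ψ (and hence ¬⟨D⟩ψ = [D]¬ψ = ¬⟨D⟩¬¬ψ):
-- we work with canonical representatives in which no double negation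
-- occurs.  '∼' is negation on canonical representatives.

∼_ : Formula → Formula
∼ neg ψ = ψ
∼ prop p = neg (prop p)
∼ or a b = neg (or a b)
∼ dia a = neg (dia a)

nf : Formula → Formula
nf (prop p) = prop p
nf (neg ψ) = ∼ nf ψ
nf (or a b) = or (nf a) (nf b)
nf (dia a) = dia (nf a)

sub : Formula → List Formula
sub (prop p) = prop p ∷ []
sub (neg ψ) = neg ψ ∷ sub ψ
sub (or a b) = or a b ∷ (sub a ++ sub b)
sub (dia a) = dia a ∷ sub a

CLlist : Formula → List Formula
CLlist φ = deduplicate _≟F_ (concatMap (λ ψ → ψ ∷ (∼ ψ) ∷ []) (sub (nf φ)))

size : Formula → ℕ
size φ = length (CLlist φ)

CL : (φ : Formula) → Vec Formula (size φ)
CL φ = fromList (CLlist φ)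

SubCL : Formula → Set
SubCL φ = Subset (size φ)

_∈CL_ : Formula → Formula → Set
ψ ∈CL φ = Σ (Fin (size φ)) λ i → lookup (CL φ) i ≡ ψ

mem : (φ : Formula) → Formula → SubCL φ → Set
mem φ ψ A = Σ (Fin (size φ)) λ i → (lookup (CL φ) i ≡ ψ) × (i ∈ A)

record IsAtom (φ : Formula) (A : SubCL φ) : Set where
  field
    negation : ∀ ψ → ψ ∈CL φ → (mem φ ψ A ⇔ (¬ mem φ (∼ ψ) A))
    disj     : ∀ ψ₁ ψ₂ → or ψ₁ ψ₂ ∈CL φ →
               (mem φ (or ψ₁ ψ₂) A ⇔ (mem φ ψ₁ A ⊎ mem φ ψ₂ A))

Req : (φ : Formula) → SubCL φ → Formula → Set
Req φ A ψ = mem φ (dia ψ) A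

REQ : Formula → Formula → Set
REQ φ ψ = dia ψ ∈CL φ

Obs : (φ : Formula) → SubCL φ → Formula → Set
Obs φ A ψ = mem φ ψ A × REQ φ ψ

-- rank(A) = |REQ_φ| − |Req_D(A)|.
-- Since CL φ is duplicate-free, |REQ_φ| is the number of positions of CL φ
-- holding a formula ⟨D⟩ψ, and |Req_D(A)| the number of such positions in A.

isDia : Formula → Bool
isDia (dia _) = true
isDia (prop _) = false
isDia (neg _) = false
isDia (or _ _) = false

diaMask : (φ : Formula) → SubCL φ
diaMask φ = tabulate (λ i → isDia (lookup (CL φ) i))

rank : (φ : Formula) → SubCL φ → ℕ
rank φ A = ∣ diaMask φ ∣ ∸ ∣ A ∩ diaMask φ ∣

Step : (φ : Formula) → SubCL φ → SubCL φ → SubCL φ → Set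
Step φ A₁ A₂ A₃ =
  IsAtom φ A₃ ×
  (∀ p → mem φ (prop p) A₃ ⇔ (mem φ (prop p) A₁ × mem φ (prop p) A₂)) ×
  (∀ ψ → Req φ A₃ ψ ⇔
           (Req φ A₁ ψ ⊎ Req φ A₂ ψ ⊎ Obs φ A₁ ψ ⊎ Obs φ A₂ ψ))

data SuccFrom (φ : Formula) : List (SubCL φ) → SubCL φ → List (SubCL φ) → Set where
  done : ∀ {B} → SuccFrom φ [] B (B ∷ [])
  step : ∀ {r row B B′ out} → Step φ r B B′ →
         SuccFrom φ row B′ out → SuccFrom φ (r ∷ row) B (B ∷ out)

IsSucc : (φ : Formula) → List (SubCL φ) → SubCL φ → List (SubCL φ) → Set
IsSucc φ row A out = SuccFrom φ row A out

module Submission where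

-- Write next X for the unique atom with B X ⇒ next X, so that succ_φ(B^m, A) is the orbit
-- A, next A, next² A, … .  Every next X contains Req_D(B) and Req_D(X), hence
-- rank(next X) ≤ rank(B) and Req_D grows weakly along the orbit.  For Y = next X the
-- propositions of next Y are those of B ∩ Y = Y, so as soon as Req_D(next Y) = Req_D(Y)
-- the orbit has reached a fixed point.  Thus after A the orbit strictly enlarges Req_D,
-- through pairwise distinct atoms, until it stabilises; this takes at most
-- rank(next A) ≤ rank(B) < m steps, and the remaining copies of the fixed point
-- outnumber its rank.

open import Defs
open import Data.Nat using (ℕ; zero; suc; _+_; _<_; _≤_; _∸_; z≤n; s≤s)
open import Data.Nat.Properties using (≤-pred; n≮0; ≤-refl; ≤-trans; <⇒≤; <-≤-trans; <-irrefl; ∸-monoʳ-≤; ∸-monoʳ-<; _<?_)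
open import Data.Bool using (Bool; true; false; T; not; _∨_)
open import Data.Bool.Properties using (T-∨; T-≡; T?; not-involutive)
open import Data.Fin.Properties using (any?)
open import Data.Fin.Subset using (Subset; _∈_; _⊆_; ∣_∣; _∩_)
open import Data.Fin.Subset.Properties using (_∈?_; ⊆-antisym; p⊆q⇒∣p∣≤∣q∣; p⊂q⇒∣p∣<∣q∣; x∈p∩q⁺; x∈p∩q⁻; p∩q⊆q)
open import Data.List using (List; []; _∷_; _++_; replicate; iterate; concatMap)
open import Data.List.Membership.Propositional using (find; lose) renaming (_∈_ to _∈ₗ_)
open import Data.List.Membership.Propositional.Properties using (∈-++⁻; ∈-++⁺ˡ; ∈-++⁺ʳ; ∈-concatMap⁺; ∈-concatMap⁻; ∈-deduplicate⁻; ∈-deduplicate⁺)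
open import Data.List.Relation.Unary.Any using (here; there)
import Data.List.Relation.Unary.All as All
open import Data.List.Relation.Unary.All using (All; []; _∷_)
open import Data.List.Relation.Unary.AllPairs using ([]; _∷_)
open import Data.Vec.Relation.Unary.AllPairs using ([]; _∷_)
open import Data.List.Relation.Unary.Unique.Propositional using (Unique)
open import Data.List.Relation.Unary.Unique.DecPropositional.Properties _≟F_ using (deduplicate-!)
open import Data.Vec using (Vec; []; _∷_; toList; init; last; lookup; tabulate; fromList)
open import Data.Vec.Properties using ([]=⇒lookup; lookup⇒[]=; lookup∘tabulate)
open import Data.Vec.Membership.Propositional.Properties using (∈-fromList⁻; ∈-fromList⁺) renaming (∈-lookup to ∈ᵥ-lookup)
import Data.Vec.Relation.Unary.Any as VAny
open import Data.Vec.Relation.Unary.Any.Properties using (lookup-index)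
import Data.Vec.Relation.Unary.Unique.Propositional as VUnique
open import Data.Vec.Relation.Unary.Unique.Propositional.Properties using (lookup-injective)
import Data.Vec.Relation.Unary.All.Properties as VAll
open import Data.Product using (Σ; ∃; _×_; _,_; proj₁; proj₂)
open import Data.Sum as Sum using (_⊎_; inj₁; inj₂)
open import Relation.Nullary using (¬_; Dec; yes; no; contradiction)
open import Relation.Nullary.Decidable using (⌊_⌋; _×-dec_; _⊎-dec_; toWitness; fromWitness; decidable-stable)
open import Function using (_∘_)
open import Relation.Binary.PropositionalEquality using (_≡_; _≢_; refl; sym; trans; cong; subst; module ≡-Reasoning)
open ≡-Reasoning
open import Function.Bundles using (_⇔_; mk⇔; Equivalence)
open Equivalence using (to; from)
open import Function.Properties.Equivalence using () renaming (trans to ⇔-trans; sym to ⇔-sym)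

replicate-+ : ∀ {S : Set} m n (x : S) → replicate (m + n) x ≡ replicate m x ++ replicate n x
replicate-+ zero n x = refl
replicate-+ (suc m) n x = cong (x ∷_) (replicate-+ m n x)

T-not⇔¬T : ∀ {b} → T (not b) ⇔ (¬ T b)
T-not⇔¬T {true} = mk⇔ (λ ()) (λ ¬t → ¬t _)
T-not⇔¬T {false} = mk⇔ (λ _ ()) (λ _ → _)

⊆-≮⇒⊇ : ∀ {n} {p q : Subset n} → p ⊆ q → ¬ ∣ p ∣ < ∣ q ∣ → q ⊆ p
⊆-≮⇒⊇ {p = p} p⊆q ∣p∣≮∣q∣ {i} i∈q with i ∈? p
... | yes i∈p = i∈p
... | no i∉p = contradiction (p⊂q⇒∣p∣<∣q∣ (p⊆q , i , i∈q , i∉p)) ∣p∣≮∣q∣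

⊆⇒⊇⊎∣∣< : ∀ {n} {p q : Subset n} → p ⊆ q → q ⊆ p ⊎ ∣ p ∣ < ∣ q ∣
⊆⇒⊇⊎∣∣< {p = p} {q} p⊆q with ∣ p ∣ <? ∣ q ∣
... | yes ∣p∣<∣q∣ = inj₂ ∣p∣<∣q∣
... | no ∣p∣≮∣q∣ = inj₁ (⊆-≮⇒⊇ p⊆q ∣p∣≮∣q∣)

module Stabilisation {S : Set} (f : S → S) (μ : S → ℕ) {M : ℕ} (μ≤M : ∀ X → μ X ≤ M)
                     (progress : ∀ X → f (f X) ≡ f X ⊎ μ (f X) < μ (f (f X))) where

  iterate-fixed : ∀ {Z} → f Z ≡ Z → ∀ k → iterate f Z k ≡ replicate k Z
  iterate-fixed fZ≡Z zero = refl
  iterate-fixed {Z} fZ≡Z (suc k) rewrite fZ≡Z = cong (Z ∷_) (iterate-fixed fZ≡Z k)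

  below-∉ : ∀ {a b} {Zs : List S} → μ a < μ b → All (λ Z → μ b ≤ μ Z) Zs → All (a ≢_) Zs
  below-∉ μa<μb = All.map λ { μb≤μZ refl → <-irrefl refl (<-≤-trans μa<μb μb≤μZ) }

  gap-shrinks : ∀ {X Y} → μ X < μ Y → M ∸ μ Y < M ∸ μ X
  gap-shrinks {Y = Y} μX<μY = ∸-monoʳ-< μX<μY (μ≤M Y)

  record EventuallyConstant (Y : S) (n : ℕ) : Set where
    field
      {length} : ℕ
      states : Vec S (suc length)
      repeats : ℕ
      repeats-positive : 1 ≤ repeats
      trace : iterate f Y (suc n) ≡ toList (init states) ++ replicate repeats (last states)
      distinct : Unique (toList states)
      slack : M ∸ μ (last states) < repeats
      stable : ∀ t → iterate f Y (suc n + t) ≡ iterate f Y (suc n) ++ replicate t (last states)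
      above : All (λ Z → μ Y ≤ μ Z) (toList states)

  stabilise : ∀ n X → M ∸ μ (f X) ≤ n → EventuallyConstant (f X) n
  stabilise n X gap≤n with progress X
  ... | inj₁ fixed = record
    { states = f X ∷ []
    ; repeats = suc n
    ; repeats-positive = s≤s z≤n
    ; trace = iterate-fixed fixed (suc n)
    ; distinct = [] ∷ []
    ; slack = s≤s gap≤n
    ; stable = λ t → begin
        iterate f (f X) (suc n + t)                          ≡⟨ iterate-fixed fixed (suc n + t) ⟩
        replicate (suc n + t) (f X)                           ≡⟨ replicate-+ (suc n) t (f X) ⟩
        replicate (suc n) (f X) ++ replicate t (f X)          ≡⟨ cong (_++ replicate t (f X)) (sym (iterate-fixed fixed (suc n))) ⟩
        iterate f (f X) (suc n) ++ replicate t (f X)          ∎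
    ; above = ≤-refl ∷ []
    }
  stabilise zero X gap≤0 | inj₂ μ< = contradiction (<-≤-trans (gap-shrinks μ<) gap≤0) n≮0
  stabilise (suc n) X gap≤1+n | inj₂ μ< = record
    { states = f X ∷ states
    ; repeats = repeats
    ; repeats-positive = repeats-positive
    ; trace = cong (f X ∷_) trace
    ; distinct = below-∉ μ< above ∷ distinct
    ; slack = slack
    ; stable = λ t → cong (f X ∷_) (stable t)
    ; above = ≤-refl ∷ All.map (≤-trans (<⇒≤ μ<)) above
    }
    where open EventuallyConstant (stabilise n (f X) (≤-pred (<-≤-trans (gap-shrinks μ<) gap≤1+n)))

sub-refl : ∀ ψ → ψ ∈ₗ sub ψ
sub-refl (prop _) = here refl
sub-refl (neg _) = here refl
sub-refl (or _ _) = here refl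
sub-refl (dia _) = here refl

sub-trans : ∀ ψ {χ θ} → χ ∈ₗ sub ψ → θ ∈ₗ sub χ → θ ∈ₗ sub ψ
sub-trans (prop _) (here refl) θ∈ = θ∈
sub-trans (neg _) (here refl) θ∈ = θ∈
sub-trans (or _ _) (here refl) θ∈ = θ∈
sub-trans (dia _) (here refl) θ∈ = θ∈
sub-trans (neg ψ) (there χ∈) θ∈ = there (sub-trans ψ χ∈ θ∈)
sub-trans (or a b) (there χ∈) θ∈ with ∈-++⁻ (sub a) χ∈
... | inj₁ χ∈a = there (∈-++⁺ˡ (sub-trans a χ∈a θ∈))
... | inj₂ χ∈b = there (∈-++⁺ʳ (sub a) (sub-trans b χ∈b θ∈))
sub-trans (dia ψ) (there χ∈) θ∈ = there (sub-trans ψ χ∈ θ∈)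

module Closure (φ : Formula) where

  private
    pair : Formula → List Formula
    pair χ = χ ∷ ∼ χ ∷ []

  ∈CL⇒∈CLlist : ∀ {ψ} → ψ ∈CL φ → ψ ∈ₗ CLlist φ
  ∈CL⇒∈CLlist (i , refl) = ∈-fromList⁻ (∈ᵥ-lookup i (CL φ))

  ∈CLlist⇒∈CL : ∀ {ψ} → ψ ∈ₗ CLlist φ → ψ ∈CL φ
  ∈CLlist⇒∈CL ψ∈ = VAny.index (∈-fromList⁺ ψ∈) , sym (lookup-index (∈-fromList⁺ ψ∈))

  ∈CL⁻ : ∀ {ψ} → ψ ∈CL φ → ∃ λ χ → χ ∈ₗ sub (nf φ) × (ψ ≡ χ ⊎ ψ ≡ ∼ χ)
  ∈CL⁻ ψ∈ with find (∈-concatMap⁻ pair (∈-deduplicate⁻ _≟F_ _ (∈CL⇒∈CLlist ψ∈)))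
  ... | χ , χ∈ , here eq = χ , χ∈ , inj₁ eq
  ... | χ , χ∈ , there (here eq) = χ , χ∈ , inj₂ eq

  ∈CL⁺ : ∀ {ψ χ} → χ ∈ₗ sub (nf φ) → ψ ≡ χ ⊎ ψ ≡ ∼ χ → ψ ∈CL φ
  ∈CL⁺ {χ = χ} χ∈ eq = ∈CLlist⇒∈CL (∈-deduplicate⁺ _≟F_ (∈-concatMap⁺ pair (lose χ∈ (pick eq))))
    where
    pick : ∀ {ψ} → ψ ≡ χ ⊎ ψ ≡ ∼ χ → ψ ∈ₗ χ ∷ ∼ χ ∷ []
    pick (inj₁ eq) = here eq
    pick (inj₂ eq) = there (here eq)

  lookup-CL-injective : ∀ i j → lookup (CL φ) i ≡ lookup (CL φ) j → i ≡ j
  lookup-CL-injective = lookup-injective (Unique-fromList (deduplicate-! (concatMap pair (sub (nf φ)))))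
    where
    Unique-fromList : ∀ {xs : List Formula} → Unique xs → VUnique.Unique (fromList xs)
    Unique-fromList [] = []
    Unique-fromList (x∉ ∷ u) = VAll.fromList⁺ x∉ ∷ Unique-fromList u

  -- ∼ is not involutive on χ = neg χ′, but then ∼ ψ = ∼ χ′ is listed since χ′ is a subformula too.
  ∼-∈CL : ∀ {ψ} → ψ ∈CL φ → (∼ ψ) ∈CL φ
  ∼-∈CL ψ∈ with ∈CL⁻ ψ∈
  ... | _ , χ∈ , inj₁ refl = ∈CL⁺ χ∈ (inj₂ refl)
  ... | neg χ , χ∈ , inj₂ refl = ∈CL⁺ (sub-trans (nf φ) χ∈ (there (sub-refl χ))) (inj₂ refl)
  ... | prop _ , χ∈ , inj₂ refl = ∈CL⁺ χ∈ (inj₁ refl)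
  ... | or _ _ , χ∈ , inj₂ refl = ∈CL⁺ χ∈ (inj₁ refl)
  ... | dia _ , χ∈ , inj₂ refl = ∈CL⁺ χ∈ (inj₁ refl)

  or∈sub⇒∈CL : ∀ {a b} → or a b ∈ₗ sub (nf φ) → a ∈CL φ × b ∈CL φ
  or∈sub⇒∈CL {a} {b} ab∈ = ∈CL⁺ (sub-trans (nf φ) ab∈ (there (∈-++⁺ˡ (sub-refl a)))) (inj₁ refl)
                         , ∈CL⁺ (sub-trans (nf φ) ab∈ (there (∈-++⁺ʳ (sub a) (sub-refl b)))) (inj₁ refl)

  or-∈CL : ∀ {a b} → or a b ∈CL φ → a ∈CL φ × b ∈CL φ
  or-∈CL ab∈ with ∈CL⁻ ab∈
  ... | _ , χ∈ , inj₁ refl = or∈sub⇒∈CL χ∈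
  ... | neg _ , χ∈ , inj₂ refl = or∈sub⇒∈CL (sub-trans (nf φ) χ∈ (there (sub-refl _)))
  ... | prop _ , _ , inj₂ ()
  ... | or _ _ , _ , inj₂ ()
  ... | dia _ , _ , inj₂ ()

  ∈CL? : ∀ ψ → Dec (ψ ∈CL φ)
  ∈CL? ψ = any? λ i → lookup (CL φ) i ≟F ψ

  mem? : ∀ ψ X → Dec (mem φ ψ X)
  mem? ψ X = any? λ i → (lookup (CL φ) i ≟F ψ) ×-dec (i ∈? X)

  mem⇒∈CL : ∀ {ψ X} → mem φ ψ X → ψ ∈CL φ
  mem⇒∈CL (i , eq , _) = i , eq

  mem-⊆ : ∀ {X Y} → (∀ {ψ} → mem φ ψ X → mem φ ψ Y) → X ⊆ Y
  mem-⊆ X⇒Y {i} i∈X with X⇒Y (i , refl , i∈X)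
  ... | j , eq , j∈Y with lookup-CL-injective j i eq
  ... | refl = j∈Y

module Atoms (φ : Formula) where
  open Closure φ
  open IsAtom

  neg-mono : ∀ {X Y χ} → IsAtom φ X → IsAtom φ Y →
             (mem φ χ Y → mem φ χ X) → mem φ (neg χ) X → mem φ (neg χ) Y
  neg-mono {χ = χ} aX aY χY⇒χX ¬χ∈X =
    from (negation aY (neg χ) c) λ χ∈Y → to (negation aX (neg χ) c) ¬χ∈X (χY⇒χX χ∈Y)
    where c = mem⇒∈CL ¬χ∈X

  or-mono : ∀ {X Y a b} → IsAtom φ X → IsAtom φ Y → (mem φ a X → mem φ a Y) →
            (mem φ b X → mem φ b Y) → mem φ (or a b) X → mem φ (or a b) Y
  or-mono {a = a} {b} aX aY aX⇒aY bX⇒bY ab∈X =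
    from (disj aY a b c) (Sum.map aX⇒aY bX⇒bY (to (disj aX a b c) ab∈X))
    where c = mem⇒∈CL ab∈X

  atom-≡ : ∀ {X Y} → IsAtom φ X → IsAtom φ Y →
           (∀ p → mem φ (prop p) X ⇔ mem φ (prop p) Y) →
           (∀ ψ → Req φ X ψ ⇔ Req φ Y ψ) → X ≡ Y
  atom-≡ {X} {Y} aX aY props reqs =
    ⊆-antisym (mem-⊆ λ {ψ} → to (mem-⇔ ψ)) (mem-⊆ λ {ψ} → from (mem-⇔ ψ))
    where
    mem-⇔ : ∀ ψ → mem φ ψ X ⇔ mem φ ψ Y
    mem-⇔ (prop p) = props p
    mem-⇔ (dia ψ) = reqs ψ
    mem-⇔ (neg χ) = mk⇔ (neg-mono aX aY (from (mem-⇔ χ))) (neg-mono aY aX (to (mem-⇔ χ)))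
    mem-⇔ (or a b) = mk⇔ (or-mono aX aY (to (mem-⇔ a)) (to (mem-⇔ b)))
                         (or-mono aY aX (from (mem-⇔ a)) (from (mem-⇔ b)))

  Step-functional : ∀ {B X Y Z} → Step φ B X Y → Step φ B X Z → Y ≡ Z
  Step-functional (aY , propsY , reqsY) (aZ , propsZ , reqsZ) =
    atom-≡ aY aZ (λ p → ⇔-trans (propsY p) (⇔-sym (propsZ p)))
                 (λ ψ → ⇔-trans (reqsY ψ) (⇔-sym (reqsZ ψ)))

truth : (ℕ → Bool) → (Formula → Bool) → Formula → Bool
truth P R (prop p) = P p
truth P R (neg ψ) = not (truth P R ψ)
truth P R (or a b) = truth P R a ∨ truth P R b
truth P R (dia ψ) = R ψ

truth-∼ : ∀ P R ψ → truth P R (∼ ψ) ≡ not (truth P R ψ)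
truth-∼ P R (prop _) = refl
truth-∼ P R (neg ψ) = sym (not-involutive (truth P R ψ))
truth-∼ P R (or _ _) = refl
truth-∼ P R (dia _) = refl

module Valuation (φ : Formula) (P : ℕ → Bool) (R : Formula → Bool) where
  open Closure φ

  atomOf : SubCL φ
  atomOf = tabulate (λ i → truth P R (lookup (CL φ) i))

  mem-atomOf : ∀ {ψ} → mem φ ψ atomOf ⇔ (ψ ∈CL φ × T (truth P R ψ))
  mem-atomOf = mk⇔
    (λ { (i , refl , i∈) → (i , refl) , from T-≡ (trans (sym (lookup∘tabulate _ i)) ([]=⇒lookup i∈)) })
    (λ { ((i , refl) , t) → i , refl , lookup⇒[]= i atomOf (trans (lookup∘tabulate _ i) (to T-≡ t)) })

  atomOf-isAtom : IsAtom φ atomOf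
  IsAtom.negation atomOf-isAtom ψ ψ∈ = mk⇔
    (λ ψ∈N ∼ψ∈N → to T-not⇔¬T (subst T (truth-∼ P R ψ) (proj₂ (to mem-atomOf ∼ψ∈N)))
                                (proj₂ (to mem-atomOf ψ∈N)))
    (λ ∼ψ∉N → from mem-atomOf (ψ∈ , decidable-stable (T? _) λ ¬t →
       ∼ψ∉N (from mem-atomOf (∼-∈CL ψ∈ , subst T (sym (truth-∼ P R ψ)) (from T-not⇔¬T ¬t)))))
  IsAtom.disj atomOf-isAtom a b ab∈ = mk⇔
    (λ ab∈N → Sum.map (λ t → from mem-atomOf (proj₁ (or-∈CL ab∈) , t))
                           (λ t → from mem-atomOf (proj₂ (or-∈CL ab∈) , t))
                           (to T-∨ (proj₂ (to mem-atomOf ab∈N))))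
    (λ a⊎b → from mem-atomOf (ab∈ , from T-∨ (Sum.map (proj₂ ∘ to mem-atomOf) (proj₂ ∘ to mem-atomOf) a⊎b)))

module Successor (φ : Formula) (B : SubCL φ) where
  open Closure φ
  open Atoms φ

  private
    Obs? : ∀ X ψ → Dec (Obs φ X ψ)
    Obs? X ψ = mem? ψ X ×-dec ∈CL? (dia ψ)

    props? : ∀ X p → Dec (mem φ (prop p) B × mem φ (prop p) X)
    props? X p = mem? (prop p) B ×-dec mem? (prop p) X

    reqs? : ∀ X ψ → Dec (Req φ B ψ ⊎ Req φ X ψ ⊎ Obs φ B ψ ⊎ Obs φ X ψ)
    reqs? X ψ = mem? (dia ψ) B ⊎-dec mem? (dia ψ) X ⊎-dec Obs? B ψ ⊎-dec Obs? X ψ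

  next : SubCL φ → SubCL φ
  next X = Valuation.atomOf φ (λ p → ⌊ props? X p ⌋) (λ ψ → ⌊ reqs? X ψ ⌋)

  next-step : ∀ X → Step φ B X (next X)
  next-step X = atomOf-isAtom , props⇔ , reqs⇔
    where
    open Valuation φ (λ p → ⌊ props? X p ⌋) (λ ψ → ⌊ reqs? X ψ ⌋)

    props⇔ : ∀ p → mem φ (prop p) (next X) ⇔ (mem φ (prop p) B × mem φ (prop p) X)
    props⇔ p = mk⇔ (toWitness ∘ proj₂ ∘ to mem-atomOf)
                  (λ p∈ → from mem-atomOf (mem⇒∈CL (proj₁ p∈) , fromWitness p∈))

    dia-∈CL : ∀ {ψ} → Req φ B ψ ⊎ Req φ X ψ ⊎ Obs φ B ψ ⊎ Obs φ X ψ → dia ψ ∈CL φ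
    dia-∈CL (inj₁ r) = mem⇒∈CL r
    dia-∈CL (inj₂ (inj₁ r)) = mem⇒∈CL r
    dia-∈CL (inj₂ (inj₂ (inj₁ (_ , d∈)))) = d∈
    dia-∈CL (inj₂ (inj₂ (inj₂ (_ , d∈)))) = d∈

    reqs⇔ : ∀ ψ → Req φ (next X) ψ ⇔ (Req φ B ψ ⊎ Req φ X ψ ⊎ Obs φ B ψ ⊎ Obs φ X ψ)
    reqs⇔ ψ = mk⇔ (toWitness ∘ proj₂ ∘ to mem-atomOf)
                 (λ r → from mem-atomOf (dia-∈CL r , fromWitness r))

  Req-next-B : ∀ {X ψ} → Req φ B ψ → Req φ (next X) ψ
  Req-next-B {X} {ψ} r = from (proj₂ (proj₂ (next-step X)) ψ) (inj₁ r)

  Req-next-X : ∀ {X ψ} → Req φ X ψ → Req φ (next X) ψ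
  Req-next-X {X} {ψ} r = from (proj₂ (proj₂ (next-step X)) ψ) (inj₂ (inj₁ r))

  next-unique : ∀ {X Y} → Step φ B X Y → Y ≡ next X
  next-unique {X} s = Step-functional s (next-step X)

  iterate-IsSucc : ∀ n X → IsSucc φ (replicate n B) X (iterate next X (suc n))
  iterate-IsSucc zero X = done
  iterate-IsSucc (suc n) X = step (next-step X) (iterate-IsSucc n (next X))

  IsSucc-unique : ∀ n {X out} → IsSucc φ (replicate n B) X out → out ≡ iterate next X (suc n)
  IsSucc-unique zero done = refl
  IsSucc-unique (suc n) {X} (step s rest) =
    cong (X ∷_) (trans (IsSucc-unique n rest) (cong (λ Y → iterate next Y (suc n)) (next-unique s)))

isDia⇒dia : ∀ θ → isDia θ ≡ true → ∃ λ ψ → θ ≡ dia ψ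
isDia⇒dia (dia ψ) _ = ψ , refl

module Requests (φ : Formula) (B : SubCL φ) where
  open Closure φ
  open Atoms φ
  open Successor φ B

  reqs : SubCL φ → SubCL φ
  reqs X = X ∩ diaMask φ

  ∈diaMask⁺ : ∀ {i ψ} → lookup (CL φ) i ≡ dia ψ → i ∈ diaMask φ
  ∈diaMask⁺ {i} eq = lookup⇒[]= i (diaMask φ) (trans (lookup∘tabulate _ i) (cong isDia eq))

  ∈diaMask⁻ : ∀ {i} → i ∈ diaMask φ → ∃ λ ψ → lookup (CL φ) i ≡ dia ψ
  ∈diaMask⁻ {i} i∈ = isDia⇒dia (lookup (CL φ) i) (trans (sym (lookup∘tabulate _ i)) ([]=⇒lookup i∈))

  Req⇒reqs⊆ : ∀ {X Y} → (∀ {ψ} → Req φ X ψ → Req φ Y ψ) → reqs X ⊆ reqs Y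
  Req⇒reqs⊆ {X} {Y} X⇒Y {i} i∈ with x∈p∩q⁻ X (diaMask φ) i∈
  ... | i∈X , i∈D with ∈diaMask⁻ i∈D
  ... | ψ , eq with X⇒Y (i , eq , i∈X)
  ... | j , eq′ , j∈Y with lookup-CL-injective j i (trans eq′ (sym eq))
  ... | refl = x∈p∩q⁺ (j∈Y , i∈D)

  reqs⊆⇒Req : ∀ {X Y ψ} → reqs X ⊆ reqs Y → Req φ X ψ → Req φ Y ψ
  reqs⊆⇒Req {X} {Y} X⊆Y (i , eq , i∈X) = i , eq , proj₁ (x∈p∩q⁻ Y (diaMask φ) (X⊆Y (x∈p∩q⁺ (i∈X , ∈diaMask⁺ eq))))

  rank-next : ∀ X → rank φ (next X) ≤ rank φ B
  rank-next X = ∸-monoʳ-≤ ∣ diaMask φ ∣ (p⊆q⇒∣p∣≤∣q∣ (Req⇒reqs⊆ Req-next-B))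

  Step-stable : ∀ {X Y Z} → Step φ B X Y → Step φ B Y Z → reqs Z ⊆ reqs Y → Z ≡ Y
  Step-stable (aY , propsY , _) (aZ , propsZ , reqsZ) Z⊆Y = atom-≡ aZ aY
    (λ p → mk⇔ (proj₂ ∘ to (propsZ p)) (λ p∈Y → from (propsZ p) (proj₁ (to (propsY p) p∈Y) , p∈Y)))
    (λ ψ → mk⇔ (reqs⊆⇒Req Z⊆Y) (λ r → from (reqsZ ψ) (inj₂ (inj₁ r))))

  next-progress : ∀ X → next (next X) ≡ next X ⊎ ∣ reqs (next X) ∣ < ∣ reqs (next (next X)) ∣
  next-progress X = Sum.map₁ (Step-stable (next-step X) (next-step (next X))) (⊆⇒⊇⊎∣∣< (Req⇒reqs⊆ Req-next-X))

  open Stabilisation next (λ X → ∣ reqs X ∣) (λ X → p⊆q⇒∣p∣≤∣q∣ (p∩q⊆q X (diaMask φ))) next-progress public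

lemma3p13 : (φ : Formula) (A B : SubCL φ) → IsAtom φ A → IsAtom φ B →
    (m : ℕ) → rank φ B < m →
    (Σ (List (SubCL φ)) λ out → IsSucc φ (replicate m B) A out) ×
    (∀ out → IsSucc φ (replicate m B) A out →
    Σ ℕ λ j → Σ (Vec (SubCL φ) (suc j)) λ As → Σ ℕ λ ℓ →
    (1 ≤ ℓ) ×
    (out ≡ A ∷ (toList (init As) ++ replicate ℓ (last As))) ×
    Unique (toList As) ×
    (rank φ (last As) < ℓ) ×
    (∀ t → 0 < t → ∀ out′ → IsSucc φ (replicate (m + t) B) A out′ →
    out′ ≡ out ++ replicate t (last As)))
-- A and B need not be atoms: every successor is an atom by the definition of ⇒.
lemma3p13 φ A B _ _ (suc m) (s≤s rankB≤m) =
  (iterate next A (suc (suc m)) , iterate-IsSucc (suc m) A) ,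
  λ out succ → let out≡ = IsSucc-unique (suc m) succ in
    length , states , repeats , repeats-positive , trans out≡ (cong (A ∷_) trace) ,
    distinct , slack , λ t _ out′ succ′ → begin
      out′                                                             ≡⟨ IsSucc-unique (suc m + t) succ′ ⟩
      A ∷ iterate next (next A) (suc m + t)                            ≡⟨ cong (A ∷_) (stable t) ⟩
      A ∷ iterate next (next A) (suc m) ++ replicate t (last states)   ≡⟨ cong (_++ replicate t (last states)) (sym out≡) ⟩
      out ++ replicate t (last states)                                 ∎
  where
  open Successor φ B
  open Requests φ B
  open EventuallyConstant (stabilise m A (≤-trans (rank-next A) rankB≤m))
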